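{- Consider online bipartite matching with reusable resources, as described in the context. For every resource $i\in I$, the arrival order (the total order on $T$ by arrival time) is a submodular order for the function $r_i:2^T\to\mathbb{Z}_{\ge 0}$.
   Context: There is a set $I$ of resources and a set $T$ of arrivals; arrival $t$ occurs at time $a(t)$, with distinct arrivals at distinct times, and there is a bipartite graph between $I$ and $T$. A resource $i$ matched to an arrival at time $a(t)$ is used for a fixed duration $d_i>0$ and becomes available again at time $a(t)+d_i$. For a set $S\subseteq T$, the matching process on $S$ for resource $i$ goes through the arrivals of $S$ that have an edge to $i$ in increasing order of arrival time and matches $i$ to each such arrival at which $i$ is available (i.e., not in use by an earlier match in this process); $r_i(S)$ is the total number of arrivals matched to $i$ in this process. For a set function $f$, $f(X\mid S)=f(X\cup S)-f(S)$. For a total order $\pi$ on $T$: a set $C$ succeeds a set $A$ if every element of $C$ comes after every element of $A$; sets $B\subseteq A$ are $\pi$-nested if $A\setminus B$ succeeds $B$; $\pi$ is a submodular order for $f$ if $f(C\mid A)\le f(C\mid B)$ for all $\pi$-nested $B\subseteq A\subseteq T$ and all $C\subseteq T$ that succeed $A$.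
   Formalization: The arrival times $a(t)$ and the durations $d_i$ are rational numbers. -}

module Defs where

open import Data.Nat using (ℕ; zero; suc)
open import Data.Bool using (Bool; true; false; _∧_; if_then_else_)
open import Data.Fin using (Fin)
open import Data.Fin.Subset using (Subset; _∈_; _⊆_; _∪_; _─_)
open import Data.List using (List; []; _∷_)
open import Data.List.Base using (filterᵇ)
open import Data.Vec using (lookup)
open import Data.List using (allFin)
open import Data.Product using (_×_)
open import Data.Maybe using (Maybe; just; nothing)
open import Data.Rational using (ℚ; _+_; _<_; _≤_)
open import Data.Rational.Properties using (_≤?_)
open import Relation.Nullary.Decidable using (⌊_⌋)
open import Data.Integer as ℤ using (ℤ; +_)

insertBy : {n : ℕ} → (Fin n → ℚ) → Fin n → List (Fin n) → List (Fin n)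
insertBy a t [] = t ∷ []
insertBy a t (u ∷ us) =
  if ⌊ a t ≤? a u ⌋ then t ∷ u ∷ us else u ∷ insertBy a t us

sortBy : {n : ℕ} → (Fin n → ℚ) → List (Fin n) → List (Fin n)
sortBy a [] = []
sortBy a (t ∷ ts) = insertBy a t (sortBy a ts)

-- The state
-- 'free' is the time at which the resource becomes available again
-- (nothing = never used yet, hence available).
runProcess : {n : ℕ} → (Fin n → ℚ) → ℚ → Maybe ℚ → List (Fin n) → ℕ
runProcess a d free [] = zero
runProcess a d nothing (t ∷ ts) = suc (runProcess a d (just (a t + d)) ts)
runProcess a d (just f) (t ∷ ts) =
  if ⌊ f ≤? a t ⌋
  then suc (runProcess a d (just (a t + d)) ts)
  else runProcess a d (just f) ts

r : {m n : ℕ} → (a : Fin n → ℚ) → (E : Fin m → Fin n → Bool) →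
    (d : Fin m → ℚ) → Fin m → Subset n → ℕ
r a E d i S =
  runProcess a (d i) nothing
    (sortBy a (filterᵇ (λ t → lookup S t ∧ E i t) (allFin _)))

marginal : {n : ℕ} → (Subset n → ℕ) → Subset n → Subset n → ℤ
marginal f X S = (+ f (X ∪ S)) ℤ.- (+ f S)

Succeeds : {n : ℕ} → (Fin n → Fin n → Set) → Subset n → Subset n → Set
Succeeds _≺_ C A = ∀ x y → x ∈ C → y ∈ A → y ≺ x

Nested : {n : ℕ} → (Fin n → Fin n → Set) → Subset n → Subset n → Set
Nested _≺_ B A = B ⊆ A × Succeeds _≺_ (A ─ B) B

SubmodularOrder : {n : ℕ} → (Fin n → Fin n → Set) → (Subset n → ℕ) → Set
SubmodularOrder {n} _≺_ f =
  ∀ (A B C : Subset n) → Nested _≺_ B A → Succeeds _≺_ C A →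
    marginal f C A ℤ.≤ marginal f C B

ArrivalOrder : {n : ℕ} → (Fin n → ℚ) → Fin n → Fin n → Set
ArrivalOrder a t t' = a t < a t'

-- Since C succeeds A, the process on C ∪ A first runs through the arrivals of A
-- and then continues on those of C, starting from the time at which the
-- resource becomes free after A; so r_i(C | A) is the number of matches in C of
-- a process started with that free time.  Likewise for B, and since A is B
-- followed by later arrivals, the free time after A is no earlier than after B.
-- It remains that a later initial free time never yields more matches: of two
-- runs with free times g ≤ h ≤ g + d the earlier one is at most one match
-- ahead, and whenever it takes an arrival that the later one skips, its new
-- free time lies beyond h.
module Submission where

open import Defs
open import Level using (0ℓ)
open import Data.Nat using (ℕ; suc; _+_; _∸_; _≤_; z≤n; s≤s)
open import Data.Nat.Properties using (≤-refl; m≤m+n; m+n∸m≡n; m≤n⇒m≤1+n; n≤1+n)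
open import Data.Integer as ℤ using (+_; +≤+; _⊖_)
open import Data.Integer.Properties using ([+m]-[+n]≡m⊖n; ⊖-≥; module ≤-Reasoning)
open import Data.Rational as ℚ using (ℚ; 0ℚ)
import Data.Rational.Properties as ℚ
open import Data.Bool using (Bool; true; false; T; T?; _∧_; _∨_; if_then_else_)
open import Data.Bool.Properties using (T-∧; T-≡; ∨-comm; ∧-distribʳ-∨)
open import Data.Fin as Fin using (Fin)
open import Data.Fin.Subset using (Subset; _∈_; _⊆_; _∪_; _─_)
open import Data.Fin.Subset.Properties using (drop-∷-⊆)
open import Data.Vec using (lookup; _∷_; here)
open import Data.Vec.Properties using (lookup-zipWith; lookup⇒[]=; []=⇒lookup)
open import Data.List using (List; []; _∷_; _++_; allFin; filterᵇ)
open import Data.List.Membership.Propositional using () renaming (_∈_ to _∈ₗ_)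
open import Data.List.Membership.Propositional.Properties using (∈-filter⁻)
open import Data.List.Relation.Unary.All as All using ()
import Data.List.Relation.Unary.AllPairs.Properties as AllPairs
open import Data.List.Relation.Binary.Pointwise using (Pointwise-≡⇒≡)
open import Data.List.Relation.Binary.Permutation.Propositional
  using (_↭_; refl; prep; ↭-trans; ↭-sym; ↭⇒↭ₛ)
open import Data.List.Relation.Binary.Permutation.Propositional.Properties
  using (shift; ++⁺; ∈-resp-↭)
open import Data.List.Relation.Unary.Sorted.TotalOrder.Properties
  using (↗↭↗⇒≋; AllPairs⇒Sorted; Sorted⇒AllPairs)
open import Data.Product using (_,_; proj₁; proj₂)
open import Data.Empty using (⊥-elim)
open import Data.Unit using (tt)
open import Function using (Injective; _∘_)
open import Function.Bundles using (Equivalence)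
open import Relation.Nullary using (¬_; yes; no)
open import Relation.Nullary.Decidable using (⌊_⌋; isYes≗does)
open import Relation.Nullary.Construct.Add.Infimum using (_₋; ⊥₋; [_])
open import Relation.Binary.Bundles using (DecTotalOrder)
open import Relation.Binary.Construct.Add.Infimum.NonStrict ℚ._≤_
  using (_≤₋_; ⊥₋≤_; [_]; ≤₋-trans)
open import Relation.Binary.PropositionalEquality
  using (_≡_; refl; sym; trans; cong; subst; isEquivalence; module ≡-Reasoning)

marginal-≡ : ∀ {n} (f : Subset n → ℕ) X S {k} → f (X ∪ S) ≡ f S + k → marginal f X S ≡ + k
marginal-≡ f X S {k} f[X∪S]≡fS+k = begin
  + f (X ∪ S) ℤ.- + f S  ≡⟨ cong (λ v → + v ℤ.- + f S) f[X∪S]≡fS+k ⟩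
  + (f S + k) ℤ.- + f S  ≡⟨ [+m]-[+n]≡m⊖n (f S + k) (f S) ⟩
  (f S + k) ⊖ f S        ≡⟨ ⊖-≥ (m≤m+n (f S) k) ⟩
  + (f S + k ∸ f S)      ≡⟨ cong +_ (m+n∸m≡n (f S) k) ⟩
  + k                    ∎
  where open ≡-Reasoning

filterᵇ-↭-++ : ∀ {A : Set} {p q r : A → Bool} →
               (∀ x → p x ≡ q x ∨ r x) → (∀ x → T (q x) → ¬ T (r x)) →
               ∀ xs → filterᵇ p xs ↭ filterᵇ q xs ++ filterᵇ r xs
filterᵇ-↭-++ p≡q∨r q∩r≡∅ [] = refl
filterᵇ-↭-++ {q = q} {r} p≡q∨r q∩r≡∅ (x ∷ xs)
  rewrite p≡q∨r x with q x | r x | q∩r≡∅ x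
... | true  | true  | disjoint = ⊥-elim (disjoint tt tt)
... | true  | false | _ = prep x (filterᵇ-↭-++ p≡q∨r q∩r≡∅ xs)
... | false | true  | _ =
  ↭-trans (prep x (filterᵇ-↭-++ p≡q∨r q∩r≡∅ xs)) (↭-sym (shift x (filterᵇ q xs) (filterᵇ r xs)))
... | false | false | _ = filterᵇ-↭-++ p≡q∨r q∩r≡∅ xs

T-lookup⇒∈ : ∀ {n} {p : Subset n} {x} → T (lookup p x) → x ∈ p
T-lookup⇒∈ {p = p} {x} px = lookup⇒[]= x p (Equivalence.to T-≡ px)

lookup-∪-─ : ∀ {n} {p q : Subset n} → p ⊆ q → ∀ x → lookup q x ≡ lookup p x ∨ lookup (q ─ p) x
lookup-∪-─ {p = true  ∷ p} {q ∷ qs} p⊆q Fin.zero    = []=⇒lookup (p⊆q here)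
lookup-∪-─ {p = false ∷ p} {q ∷ qs} p⊆q Fin.zero    = refl
lookup-∪-─ {p = _     ∷ p} {q ∷ qs} p⊆q (Fin.suc x) = lookup-∪-─ (drop-∷-⊆ p⊆q) x

module ArrivalSorting {n : ℕ} (a : Fin n → ℚ) (a-injective : Injective _≡_ _≡_ a) where

  byArrival : DecTotalOrder 0ℓ 0ℓ 0ℓ
  byArrival = record
    { Carrier = Fin n
    ; _≈_ = _≡_
    ; _≤_ = λ t u → a t ℚ.≤ a u
    ; isDecTotalOrder = record
      { isTotalOrder = record
        { isPartialOrder = record
          { isPreorder = record
            { isEquivalence = isEquivalence
            ; reflexive = λ { refl → ℚ.≤-refl }
            ; trans = ℚ.≤-trans
            }
          ; antisym = λ t≤u u≤t → a-injective (ℚ.≤-antisym t≤u u≤t)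
          }
        ; total = λ t u → ℚ.≤-total (a t) (a u)
        }
      ; _≟_ = Fin._≟_
      ; _≤?_ = λ t u → a t ℚ.≤? a u
      }
    }

  open DecTotalOrder byArrival using (totalOrder)
  open import Data.List.Relation.Unary.Sorted.TotalOrder totalOrder using (Sorted)
  open import Data.List.Sort.InsertionSort.Base byArrival using (insert; sort)
  open import Data.List.Sort.InsertionSort.Properties byArrival using (sort-↭; sort-↗)

  insertBy≡insert : ∀ t us → insertBy a t us ≡ insert t us
  insertBy≡insert t [] = refl
  insertBy≡insert t (u ∷ us)
    rewrite isYes≗does (a t ℚ.≤? a u) | insertBy≡insert t us = refl

  sortBy≡sort : ∀ ts → sortBy a ts ≡ sort ts
  sortBy≡sort [] = refl
  sortBy≡sort (t ∷ ts) rewrite sortBy≡sort ts = insertBy≡insert t (sort ts)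

  -- Sorted permutations of each other coincide because injectivity of a makes
  -- the arrival order antisymmetric.
  sort-++ : ∀ {xs ys zs} → xs ↭ ys ++ zs → (∀ {y z} → y ∈ₗ ys → z ∈ₗ zs → a y ℚ.≤ a z) →
            sort xs ≡ sort ys ++ sort zs
  sort-++ {xs} {ys} {zs} xs↭ys++zs ys≤zs =
    Pointwise-≡⇒≡ (↗↭↗⇒≋ totalOrder (sort-↗ xs) sorted (↭⇒↭ₛ permutation))
    where
    permutation : sort xs ↭ sort ys ++ sort zs
    permutation = ↭-trans (sort-↭ xs)
      (↭-trans xs↭ys++zs (++⁺ (↭-sym (sort-↭ ys)) (↭-sym (sort-↭ zs))))
    sorted : Sorted (sort ys ++ sort zs)
    sorted = AllPairs⇒Sorted totalOrder (AllPairs.++⁺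
      (Sorted⇒AllPairs totalOrder (sort-↗ ys))
      (Sorted⇒AllPairs totalOrder (sort-↗ zs))
      (All.tabulate λ y∈ → All.tabulate λ z∈ →
        ys≤zs (∈-resp-↭ (sort-↭ ys) y∈) (∈-resp-↭ (sort-↭ zs) z∈)))

  sortBy-++ : ∀ {xs ys zs} → xs ↭ ys ++ zs → (∀ {y z} → y ∈ₗ ys → z ∈ₗ zs → a y ℚ.≤ a z) →
              sortBy a xs ≡ sortBy a ys ++ sortBy a zs
  sortBy-++ {xs} {ys} {zs} xs↭ys++zs ys≤zs
    rewrite sortBy≡sort xs | sortBy≡sort ys | sortBy≡sort zs = sort-++ xs↭ys++zs ys≤zs

-- The state of the process is the time at which the resource becomes free,
-- with ⊥₋ (= nothing) for a resource never used.
module GreedyProcess {n : ℕ} (a : Fin n → ℚ) (d : ℚ) where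

  matches : ℚ ₋ → List (Fin n) → ℕ
  matches = runProcess a d

  freeAfter : ℚ ₋ → List (Fin n) → ℚ ₋
  freeAfter f [] = f
  freeAfter ⊥₋ (t ∷ ts) = freeAfter [ a t ℚ.+ d ] ts
  freeAfter [ f ] (t ∷ ts) =
    if ⌊ f ℚ.≤? a t ⌋ then freeAfter [ a t ℚ.+ d ] ts else freeAfter [ f ] ts

  matches-++ : ∀ f xs ys → matches f (xs ++ ys) ≡ matches f xs + matches (freeAfter f xs) ys
  matches-++ f [] ys = refl
  matches-++ ⊥₋ (t ∷ xs) ys = cong suc (matches-++ [ a t ℚ.+ d ] xs ys)
  matches-++ [ f ] (t ∷ xs) ys with f ℚ.≤? a t
  ... | yes _ = cong suc (matches-++ [ a t ℚ.+ d ] xs ys)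
  ... | no  _ = matches-++ [ f ] xs ys

  freeAfter-++ : ∀ f xs ys → freeAfter f (xs ++ ys) ≡ freeAfter (freeAfter f xs) ys
  freeAfter-++ f [] ys = refl
  freeAfter-++ ⊥₋ (t ∷ xs) ys = freeAfter-++ [ a t ℚ.+ d ] xs ys
  freeAfter-++ [ f ] (t ∷ xs) ys with f ℚ.≤? a t
  ... | yes _ = freeAfter-++ [ a t ℚ.+ d ] xs ys
  ... | no  _ = freeAfter-++ [ f ] xs ys

  freeAfter-≥ : 0ℚ ℚ.≤ d → ∀ f ts → f ≤₋ freeAfter f ts
  freeAfter-≥ 0≤d ⊥₋ ts = ⊥₋≤ _
  freeAfter-≥ 0≤d [ f ] [] = [ ℚ.≤-refl ]
  freeAfter-≥ 0≤d [ f ] (t ∷ ts) with f ℚ.≤? a t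
  ... | yes f≤t = ≤₋-trans ℚ.≤-trans [ ℚ.≤-trans f≤t t≤t+d ] (freeAfter-≥ 0≤d [ a t ℚ.+ d ] ts)
    where
    t≤t+d : a t ℚ.≤ a t ℚ.+ d
    t≤t+d = ℚ.≤-trans (ℚ.≤-reflexive (sym (ℚ.+-identityʳ (a t)))) (ℚ.+-monoʳ-≤ (a t) 0≤d)
  ... | no  _ = freeAfter-≥ 0≤d [ f ] ts

  mutual
    matches-antitone : ∀ ts {f g} → f ℚ.≤ g → matches [ g ] ts ≤ matches [ f ] ts
    matches-antitone [] _ = z≤n
    matches-antitone (t ∷ ts) {f} {g} f≤g with f ℚ.≤? a t | g ℚ.≤? a t
    ... | yes _   | yes _   = ≤-refl
    ... | yes _   | no g≰t  = matches-skip≤1+take ts (ℚ.≰⇒> g≰t)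
    ... | no f≰t  | yes g≤t = ⊥-elim (f≰t (ℚ.≤-trans f≤g g≤t))
    ... | no _    | no _    = matches-antitone ts f≤g

    -- x is the time of an arrival that a resource busy until g has to skip.
    matches-skip≤1+take : ∀ ts {x g} → x ℚ.< g → matches [ g ] ts ≤ suc (matches [ x ℚ.+ d ] ts)
    matches-skip≤1+take ts {x} {g} x<g with x ℚ.+ d ℚ.≤? g
    ... | yes x+d≤g = m≤n⇒m≤1+n (matches-antitone ts x+d≤g)
    ... | no x+d≰g  =
      matches-catch-up ts (ℚ.<⇒≤ (ℚ.≰⇒> x+d≰g)) (ℚ.+-monoˡ-≤ d (ℚ.<⇒≤ x<g))

    matches-catch-up : ∀ ts {f g} → f ℚ.≤ g → g ℚ.≤ f ℚ.+ d →
                       matches [ f ] ts ≤ suc (matches [ g ] ts)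
    matches-catch-up [] _ _ = z≤n
    matches-catch-up (t ∷ ts) {f} {g} f≤g g≤f+d with f ℚ.≤? a t | g ℚ.≤? a t
    ... | yes _   | yes _   = n≤1+n _
    ... | yes f≤t | no _    = s≤s (matches-antitone ts (ℚ.≤-trans g≤f+d (ℚ.+-monoˡ-≤ d f≤t)))
    ... | no f≰t  | yes g≤t = ⊥-elim (f≰t (ℚ.≤-trans f≤g g≤t))
    ... | no _    | no _    = matches-catch-up ts f≤g g≤f+d

  matches-antitone₋ : ∀ ts {f g} → f ≤₋ g → matches g ts ≤ matches f ts
  matches-antitone₋ ts (⊥₋≤ ⊥₋) = ≤-refl
  matches-antitone₋ [] (⊥₋≤ [ g ]) = z≤n
  matches-antitone₋ (t ∷ ts) (⊥₋≤ [ g ]) with g ℚ.≤? a t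
  ... | yes _   = ≤-refl
  ... | no g≰t  = matches-skip≤1+take ts (ℚ.≰⇒> g≰t)
  matches-antitone₋ ts [ f≤g ] = matches-antitone ts f≤g

module SingleResource {n : ℕ} (a : Fin n → ℚ) (a-injective : Injective _≡_ _≡_ a)
                      (adjacent : Fin n → Bool) (d : ℚ) where

  open ArrivalSorting a a-injective using (sortBy-++)
  open GreedyProcess a d

  neighboursIn : Subset n → List (Fin n)
  neighboursIn S = filterᵇ (λ t → lookup S t ∧ adjacent t) (allFin n)

  arrivals : Subset n → List (Fin n)
  arrivals S = sortBy a (neighboursIn S)

  reward : Subset n → ℕ
  reward S = matches ⊥₋ (arrivals S)

  ∈-neighboursIn : ∀ {S t} → t ∈ₗ neighboursIn S → t ∈ S
  ∈-neighboursIn t∈ =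
    T-lookup⇒∈ (proj₁ (Equivalence.to T-∧ (proj₂ (∈-filter⁻ (T? ∘ _) {xs = allFin n} t∈))))

  arrivals-split : ∀ S S₁ S₂ → (∀ t → lookup S t ≡ lookup S₁ t ∨ lookup S₂ t) →
                   Succeeds (ArrivalOrder a) S₂ S₁ → arrivals S ≡ arrivals S₁ ++ arrivals S₂
  arrivals-split S S₁ S₂ S≡S₁∪S₂ S₂≻S₁ = sortBy-++
    (filterᵇ-↭-++ distrib disjoint (allFin n))
    (λ y∈ z∈ → ℚ.<⇒≤ (S₂≻S₁ _ _ (∈-neighboursIn z∈) (∈-neighboursIn y∈)))
    where
    distrib : ∀ t → lookup S t ∧ adjacent t ≡ (lookup S₁ t ∧ adjacent t) ∨ (lookup S₂ t ∧ adjacent t)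
    distrib t = trans (cong (_∧ adjacent t) (S≡S₁∪S₂ t))
                      (∧-distribʳ-∨ (adjacent t) (lookup S₁ t) (lookup S₂ t))
    disjoint : ∀ t → T (lookup S₁ t ∧ adjacent t) → ¬ T (lookup S₂ t ∧ adjacent t)
    disjoint t t∈S₁ t∈S₂ = ℚ.<-irrefl refl (S₂≻S₁ t t (member S₂ t∈S₂) (member S₁ t∈S₁))
      where
      member : ∀ S′ → T (lookup S′ t ∧ adjacent t) → t ∈ S′
      member S′ = T-lookup⇒∈ ∘ proj₁ ∘ Equivalence.to T-∧

  reward-∪ : ∀ {C S} → Succeeds (ArrivalOrder a) C S →
             reward (C ∪ S) ≡ reward S + matches (freeAfter ⊥₋ (arrivals S)) (arrivals C)
  reward-∪ {C} {S} C≻S = trans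
    (cong (matches ⊥₋) (arrivals-split (C ∪ S) S C lookup-C∪S C≻S))
    (matches-++ ⊥₋ (arrivals S) (arrivals C))
    where
    lookup-C∪S : ∀ t → lookup (C ∪ S) t ≡ lookup S t ∨ lookup C t
    lookup-C∪S t = trans (lookup-zipWith _∨_ t C S) (∨-comm (lookup C t) (lookup S t))

  freeAfter-nested : 0ℚ ℚ.≤ d → ∀ {A B} → Nested (ArrivalOrder a) B A →
                     freeAfter ⊥₋ (arrivals B) ≤₋ freeAfter ⊥₋ (arrivals A)
  freeAfter-nested 0≤d {A} {B} (B⊆A , A─B≻B) =
    subst (freeAfter ⊥₋ (arrivals B) ≤₋_) (sym freeAfter-A) (freeAfter-≥ 0≤d _ (arrivals (A ─ B)))
    where
    freeAfter-A : freeAfter ⊥₋ (arrivals A) ≡ freeAfter (freeAfter ⊥₋ (arrivals B)) (arrivals (A ─ B))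
    freeAfter-A = trans (cong (freeAfter ⊥₋) (arrivals-split A B (A ─ B) (lookup-∪-─ B⊆A) A─B≻B))
                        (freeAfter-++ ⊥₋ (arrivals B) (arrivals (A ─ B)))

lemma2 : (m n : ℕ) (a : Fin n → ℚ) (E : Fin m → Fin n → Bool) (d : Fin m → ℚ) →
         (∀ t t' → a t ≡ a t' → t ≡ t') →
         (∀ i → 0ℚ ℚ.< d i) →
         ∀ i → SubmodularOrder (ArrivalOrder a) (r a E d i)
lemma2 m n a E d a-injective d>0 i A B C nested@(B⊆A , _) C≻A = begin
  marginal reward C A                                    ≡⟨ marginal-≡ reward C A (reward-∪ C≻A) ⟩
  + matches (freeAfter ⊥₋ (arrivals A)) (arrivals C)     ≤⟨ +≤+ (matches-antitone₋ (arrivals C)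
                                                              (freeAfter-nested (ℚ.<⇒≤ (d>0 i)) nested)) ⟩
  + matches (freeAfter ⊥₋ (arrivals B)) (arrivals C)     ≡⟨ marginal-≡ reward C B (reward-∪ C≻B) ⟨
  marginal reward C B                                    ∎
  where
  open SingleResource a (λ {t} {t'} → a-injective t t') (E i) (d i)
  open GreedyProcess a (d i)
  open ≤-Reasoning
  C≻B : Succeeds (ArrivalOrder a) C B
  C≻B x y x∈C y∈B = C≻A x y x∈C (B⊆A y∈B)
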